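{- For each $i\in[n-1]$ the map $\delta_i$ is well-defined as a map $\mathrm{UFR}_n\to\mathrm{UFR}_n$: for every $\alpha\in\mathrm{UFR}_n$ such that none of the values $i-1$, $i$, $i+1$ occurs exactly twice in $\alpha$, the value $i+1$ occurs exactly once in $\alpha$ and the tuple $\widehat{\alpha}(i)$ obtained from $\alpha$ by replacing this occurrence of $i+1$ by $i$ lies in $\mathrm{UFR}_n$.
   Context: $[n]=\{1,\ldots,n\}$. Parking process: $\alpha=(a_1,\ldots,a_n)\in[n]^n$ encodes preferences of cars $1,\ldots,n$ arriving in order at a one-way street with spots $1,\ldots,n$; car $i$ parks in spot $a_i$ if free, otherwise in the first free spot after $a_i$, if any. $\alpha$ is a parking function if all cars park. A unit interval parking function is a parking function in which each car $i$ parks in spot $a_i$ or $a_i+1$. A Fubini ranking is a tuple $(r_1,\ldots,r_n)\in[n]^n$ with $r_i=1+|\{j:r_j<r_i\}|$ for all $i$. $\mathrm{UFR}_n$ is the set of unit Fubini rankings of length $n$: tuples that are both Fubini rankings and unit interval parking functions. For $i\in[n-1]$, $\delta_i:\mathrm{UFR}_n\to\mathrm{UFR}_n$ is defined by $\delta_i(\alpha)=\alpha$ if $|\{j:a_j=i-1\}|=2$ or $|\{j:a_j=i\}|=2$ or $|\{j:a_j=i+1\}|=2$, and $\delta_i(\alpha)=\widehat{\alpha}(i)$ otherwise, where $\widehat{\alpha}(i)$ is obtained from $\alpha$ by decreasing the single occurrence of $i+1$ to $i$. -}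

module Defs where

open import Data.Nat using (ℕ; zero; suc; _+_; _∸_; _≤_; _<_)
open import Data.Nat.Properties using (_≟_; _<?_)
open import Data.Bool using (Bool; true; false; if_then_else_)
open import Data.Maybe using (Maybe; just; nothing)
open import Data.List using (List; []; _∷_; _++_)
open import Data.List.Membership.DecPropositional _≟_ using (_∈?_)
open import Data.Vec using (Vec; []; _∷_; toList; lookup; map)
open import Data.Fin using (Fin)
open import Data.Product using (_×_; Σ; ∃)
open import Relation.Nullary using (Dec; yes; no; ¬_)
open import Relation.Nullary.Decidable using (⌊_⌋)
open import Relation.Binary.PropositionalEquality using (_≡_)

countL : ℕ → List ℕ → ℕ
countL x [] = 0
countL x (a ∷ as) = if ⌊ a ≟ x ⌋ then suc (countL x as) else countL x as

count : ∀ {n} → ℕ → Vec ℕ n → ℕ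
count x α = countL x (toList α)

firstFree : ℕ → List ℕ → ℕ → ℕ → Maybe ℕ
firstFree n occ s zero = nothing
firstFree n occ s (suc k) with n <? s
... | yes _ = nothing
... | no _ with s ∈? occ
...   | yes _ = firstFree n occ (suc s) k
...   | no _ = just s

parkFrom : ℕ → List ℕ → List ℕ → Maybe (List ℕ)
parkFrom n occ [] = just []
parkFrom n occ (a ∷ as) with firstFree n occ a (suc n)
... | nothing = nothing
... | just s with parkFrom n (s ∷ occ) as
...   | nothing = nothing
...   | just ss = just (s ∷ ss)

outcome : ∀ {n} → Vec ℕ n → Maybe (List ℕ)
outcome {n} α = parkFrom n [] (toList α)

InRange : ∀ {n} → Vec ℕ n → Set
InRange {n} α = (j : Fin n) → 1 ≤ lookup α j × lookup α j ≤ n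

IsParkingFunction : ∀ {n} → Vec ℕ n → Set
IsParkingFunction α = InRange α × Σ (List ℕ) (λ ps → outcome α ≡ just ps)

UnitCond : List ℕ → List ℕ → Set
UnitCond [] [] = Data.Unit.⊤ where import Data.Unit
UnitCond [] (_ ∷ _) = Data.Empty.⊥ where import Data.Empty
UnitCond (_ ∷ _) [] = Data.Empty.⊥ where import Data.Empty
UnitCond (a ∷ as) (p ∷ ps) = (p ≡ a Data.Sum.⊎ p ≡ suc a) × UnitCond as ps
  where import Data.Sum

IsUnitIntervalPF : ∀ {n} → Vec ℕ n → Set
IsUnitIntervalPF α =
  InRange α × Σ (List ℕ) (λ ps → outcome α ≡ just ps × UnitCond (toList α) ps)

countLess : ∀ {n} → ℕ → Vec ℕ n → ℕ
countLess x α = go (toList α)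
  where
  go : List ℕ → ℕ
  go [] = 0
  go (r ∷ rs) = if ⌊ r <? x ⌋ then suc (go rs) else go rs

IsFubiniRanking : ∀ {n} → Vec ℕ n → Set
IsFubiniRanking α = InRange α × ((j : Fin _) → lookup α j ≡ suc (countLess (lookup α j) α))

IsUFR : ∀ {n} → Vec ℕ n → Set
IsUFR α = IsFubiniRanking α × IsUnitIntervalPF α

hat : ∀ {n} → ℕ → Vec ℕ n → Vec ℕ n
hat i α = map (λ a → if ⌊ a ≟ suc i ⌋ then i else a) α

-- A unit interval parking function takes each value at most twice: car j ends in spot a_j or
-- a_j + 1, and spots are distinct. In a Fubini ranking an occurring value x is one more than the
-- number of smaller entries, so a value w + 1 ≤ n that does not occur forces w to occur twice.
-- Hence, when none of i - 1, i, i + 1 occurs twice, both i and i + 1 occur exactly once, and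
-- merging them into a block of two keeps the Fubini property and multiplicities at most two.
-- Finally, every Fubini ranking with multiplicities at most two is a unit interval parking
-- function: the first car preferring v finds v free, the second finds v taken and v + 1 free.
module Submission where

open import Defs
open import Data.Nat using (ℕ; _≤_; _<_; _∸_; suc)
open import Data.Vec using (Vec)
open import Data.Product using (_×_)
open import Relation.Nullary using (¬_)
open import Relation.Binary.PropositionalEquality using (_≡_)

open import Data.Nat using (zero; _+_; z≤n; s≤s; s≤s⁻¹; z<s)
open import Data.Nat.Properties
open import Data.Bool using (if_then_else_)
open import Data.Maybe using (just)
open import Data.Maybe.Properties using (just-injective)
open import Data.List as List using (List; []; _∷_; length)
open import Data.List.Relation.Unary.Any using (here; there)
open import Data.List.Membership.DecPropositional _≟_ using (_∈_; _∉_; _∈?_)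
open import Data.Vec using (toList; lookup)
open import Data.Vec.Properties using (toList-map; lookup-map; length-toList)
import Data.Vec.Relation.Unary.Any as VecAny
open import Data.Vec.Relation.Unary.Any.Properties using (toList⁻; lookup-index)
open import Data.Product using (_,_; ∃-syntax; proj₁; proj₂)
open import Data.Sum using (_⊎_; inj₁; inj₂)
open import Data.Empty using (⊥-elim)
open import Data.Unit using (tt)
open import Function.Base using (_∘_)
open import Function.Bundles using (_⇔_; mk⇔; Equivalence)
open import Relation.Nullary using (yes; no)
open import Relation.Nullary.Decidable using (⌊_⌋)
open import Relation.Binary.PropositionalEquality using (_≢_; refl; sym; trans; cong; cong₂; subst; module ≡-Reasoning)

countL-∷-≡ : ∀ x xs → countL x (x ∷ xs) ≡ suc (countL x xs)
countL-∷-≡ x xs with x ≟ x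
... | yes _ = refl
... | no x≢x = ⊥-elim (x≢x refl)

countL-∷-≢ : ∀ {a x} xs → a ≢ x → countL x (a ∷ xs) ≡ countL x xs
countL-∷-≢ {a} {x} xs a≢x with a ≟ x
... | yes a≡x = ⊥-elim (a≢x a≡x)
... | no _ = refl

countL-∷-≤ : ∀ x a xs → countL x xs ≤ countL x (a ∷ xs)
countL-∷-≤ x a xs with a ≟ x
... | yes _ = n≤1+n _
... | no _ = ≤-refl

countL>0⇒∈ : ∀ {x} xs → 0 < countL x xs → x ∈ xs
countL>0⇒∈ {x} (a ∷ as) c>0 with a ≟ x
... | yes a≡x = here (sym a≡x)
... | no _ = there (countL>0⇒∈ as c>0)

-- `countLess` on the underlying list; Defs only has it on vectors, with a local worker.
countLessL : ℕ → List ℕ → ℕ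
countLessL x [] = 0
countLessL x (r ∷ rs) = if ⌊ r <? x ⌋ then suc (countLessL x rs) else countLessL x rs

countLess≡countLessL : ∀ {n} x (α : Vec ℕ n) → countLess x α ≡ countLessL x (toList α)
countLess≡countLessL x Vec.[] = refl
countLess≡countLessL x (a Vec.∷ α) with a <? x
... | yes _ = cong suc (countLess≡countLessL x α)
... | no _ = countLess≡countLessL x α

countLessL-suc : ∀ x xs → countLessL (suc x) xs ≡ countLessL x xs + countL x xs
countLessL-suc x [] = refl
countLessL-suc x (r ∷ rs) with r <? suc x | r <? x | r ≟ x
... | yes _         | yes r<x | yes r≡x = ⊥-elim (<-irrefl r≡x r<x)
... | yes _         | yes _   | no _    = cong suc (countLessL-suc x rs)
... | yes _         | no _    | yes _   = trans (cong suc (countLessL-suc x rs)) (sym (+-suc _ _))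
... | yes (s≤s r≤x) | no r≮x  | no r≢x  = ⊥-elim (r≮x (≤∧≢⇒< r≤x r≢x))
... | no r≮1+x      | yes r<x | _       = ⊥-elim (r≮1+x (m<n⇒m<1+n r<x))
... | no r≮1+x      | no _    | yes r≡x = ⊥-elim (r≮1+x (s≤s (≤-reflexive r≡x)))
... | no _          | no _    | no _    = countLessL-suc x rs

countLessL-suc-absent : ∀ x xs → countL x xs ≡ 0 → countLessL (suc x) xs ≡ countLessL x xs
countLessL-suc-absent x xs c≡0 =
  trans (countLessL-suc x xs) (trans (cong (countLessL x xs +_) c≡0) (+-identityʳ _))

countLessL-zero : ∀ xs → countLessL 0 xs ≡ 0
countLessL-zero [] = refl
countLessL-zero (r ∷ rs) with r <? 0
... | no _ = countLessL-zero rs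

countLessL≤length : ∀ x xs → countLessL x xs ≤ length xs
countLessL≤length x [] = z≤n
countLessL≤length x (r ∷ rs) with r <? x
... | yes _ = s≤s (countLessL≤length x rs)
... | no _ = m≤n⇒m≤1+n (countLessL≤length x rs)

countLessL-above : ∀ n xs → (∀ {x} → x ∈ xs → x ≤ n) → countLessL (suc n) xs ≡ length xs
countLessL-above n [] _ = refl
countLessL-above n (r ∷ rs) ≤n with r <? suc n
... | yes _ = cong suc (countLessL-above n rs (λ x∈ → ≤n (there x∈)))
... | no r≮1+n = ⊥-elim (r≮1+n (s≤s (≤n (here refl))))

firstFree-here : ∀ n occ a k → a ≤ n → a ∉ occ → firstFree n occ a (suc k) ≡ just a
firstFree-here n occ a k a≤n a∉occ with n <? a
... | yes n<a = ⊥-elim (<⇒≱ n<a a≤n)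
... | no _ with a ∈? occ
...   | yes a∈occ = ⊥-elim (a∉occ a∈occ)
...   | no _ = refl

firstFree-next : ∀ n occ a → suc a ≤ n → a ∈ occ → suc a ∉ occ → firstFree n occ a (suc n) ≡ just (suc a)
firstFree-next (suc n) occ a 1+a≤n a∈occ 1+a∉occ with suc n <? a
... | yes 1+n<a = ⊥-elim (<⇒≱ 1+n<a (<⇒≤ 1+a≤n))
... | no _ with a ∈? occ
...   | yes _ = firstFree-here (suc n) occ (suc a) n 1+a≤n 1+a∉occ
...   | no a∉occ = ⊥-elim (a∉occ a∈occ)

firstFree-∉ : ∀ n occ s k {t} → firstFree n occ s k ≡ just t → t ∉ occ
firstFree-∉ n occ s (suc k) eq with n <? s
... | no _ with s ∈? occ
...   | yes _ = firstFree-∉ n occ (suc s) k eq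
...   | no s∉occ with refl ← eq = s∉occ

parkFrom-∷ : ∀ n occ a as {s ts} → firstFree n occ a (suc n) ≡ just s →
             parkFrom n (s ∷ occ) as ≡ just ts → parkFrom n occ (a ∷ as) ≡ just (s ∷ ts)
parkFrom-∷ n occ a as eq₁ eq₂ rewrite eq₁ | eq₂ = refl

parkFrom-∷⁻ : ∀ n occ a as {ps} → parkFrom n occ (a ∷ as) ≡ just ps →
              ∃[ s ] ∃[ ts ] firstFree n occ a (suc n) ≡ just s × parkFrom n (s ∷ occ) as ≡ just ts × ps ≡ s ∷ ts
parkFrom-∷⁻ n occ a as eq with firstFree n occ a (suc n) in eq₁
... | just s with parkFrom n (s ∷ occ) as in eq₂
...   | just ts = s , ts , refl , eq₂ , sym (just-injective eq)

parkFrom-avoids : ∀ n occ as {ps w} → parkFrom n occ as ≡ just ps → w ∈ occ → countL w ps ≡ 0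
parkFrom-avoids n occ [] refl _ = refl
parkFrom-avoids n occ (a ∷ as) {w = w} eq w∈occ with parkFrom-∷⁻ n occ a as eq
... | s , ts , eq₁ , eq₂ , refl with s ≟ w
...   | yes refl = ⊥-elim (firstFree-∉ n occ a (suc n) eq₁ w∈occ)
...   | no _ = parkFrom-avoids n (s ∷ occ) as eq₂ (there w∈occ)

parkFrom-distinct : ∀ n occ as {ps} → parkFrom n occ as ≡ just ps → ∀ w → countL w ps ≤ 1
parkFrom-distinct n occ [] refl w = z≤n
parkFrom-distinct n occ (a ∷ as) eq w with parkFrom-∷⁻ n occ a as eq
... | s , ts , _ , eq₂ , refl with s ≟ w
...   | yes refl = s≤s (≤-reflexive (parkFrom-avoids n (s ∷ occ) as eq₂ (here refl)))
...   | no _ = parkFrom-distinct n (s ∷ occ) as eq₂ w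

UnitCond-countL : ∀ v xs ps → UnitCond xs ps → countL v xs ≤ countL v ps + countL (suc v) ps
UnitCond-countL v [] [] _ = z≤n
UnitCond-countL v (x ∷ xs) (p ∷ ps) (p≡x⊎p≡1+x , unit) with x ≟ v
... | no _ = ≤-trans (UnitCond-countL v xs ps unit) (+-mono-≤ (countL-∷-≤ v p ps) (countL-∷-≤ (suc v) p ps))
... | yes refl with p≡x⊎p≡1+x
...   | inj₁ refl rewrite countL-∷-≡ x ps =
        s≤s (≤-trans (UnitCond-countL x xs ps unit) (+-monoʳ-≤ (countL x ps) (countL-∷-≤ (suc x) x ps)))
...   | inj₂ refl rewrite countL-∷-≡ (suc x) ps | +-suc (countL x (suc x ∷ ps)) (countL (suc x) ps) =
        s≤s (≤-trans (UnitCond-countL x xs ps unit) (+-monoˡ-≤ (countL (suc x) ps) (countL-∷-≤ x (suc x) ps)))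

UnitIntervalPF⇒count≤2 : ∀ {n} {α : Vec ℕ n} → IsUnitIntervalPF α → ∀ v → count v α ≤ 2
UnitIntervalPF⇒count≤2 {n} {α} (_ , ps , parks , unit) v =
  ≤-trans (UnitCond-countL v (toList α) ps unit) (+-mono-≤ (distinct v) (distinct (suc v)))
  where
  distinct : ∀ w → countL w ps ≤ 1
  distinct = parkFrom-distinct n [] (toList α) parks

-- The spots taken once the cars preferring `seen` have parked, if the first car preferring v
-- takes spot v and the second one spot v + 1.
Occupied : List ℕ → ℕ → Set
Occupied seen zero = 0 < countL zero seen
Occupied seen (suc v) = 0 < countL (suc v) seen ⊎ 2 ≤ countL v seen

Occupied-countL : ∀ seen s → 0 < countL s seen → Occupied seen s
Occupied-countL seen zero c>0 = c>0
Occupied-countL seen (suc v) c>0 = inj₁ c>0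

Occupied-∷⁺ : ∀ a seen s → Occupied seen s → Occupied (a ∷ seen) s
Occupied-∷⁺ a seen zero c>0 = <-≤-trans c>0 (countL-∷-≤ zero a seen)
Occupied-∷⁺ a seen (suc v) (inj₁ c>0) = inj₁ (<-≤-trans c>0 (countL-∷-≤ (suc v) a seen))
Occupied-∷⁺ a seen (suc v) (inj₂ c≥2) = inj₂ (≤-trans c≥2 (countL-∷-≤ v a seen))

Occupied-here : ∀ a seen → Occupied (a ∷ seen) a
Occupied-here a seen = Occupied-countL (a ∷ seen) a (subst (0 <_) (sym (countL-∷-≡ a seen)) z<s)

Occupied-next : ∀ a seen → 0 < countL a seen → Occupied (a ∷ seen) (suc a)
Occupied-next a seen c>0 = inj₂ (subst (2 ≤_) (sym (countL-∷-≡ a seen)) (s≤s c>0))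

Occupied-∷⁻ : ∀ a seen s → Occupied (a ∷ seen) s →
              s ≡ a ⊎ (s ≡ suc a × 0 < countL a seen) ⊎ Occupied seen s
Occupied-∷⁻ a seen zero c>0 with a ≟ zero
... | yes refl = inj₁ refl
... | no _ = inj₂ (inj₂ c>0)
Occupied-∷⁻ a seen (suc v) (inj₁ c>0) with a ≟ suc v
... | yes refl = inj₁ refl
... | no _ = inj₂ (inj₂ (inj₁ c>0))
Occupied-∷⁻ a seen (suc v) (inj₂ c≥2) with a ≟ v
... | yes refl = inj₂ (inj₁ (refl , s≤s⁻¹ c≥2))
... | no _ = inj₂ (inj₂ (inj₂ c≥2))

Tracks : List ℕ → List ℕ → Set
Tracks occ seen = ∀ s → s ∈ occ ⇔ Occupied seen s

Tracks-[] : Tracks [] []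
Tracks-[] s = mk⇔ (λ ()) (from s)
  where
  from : ∀ s → Occupied [] s → s ∈ []
  from zero ()
  from (suc v) (inj₁ ())
  from (suc v) (inj₂ ())

Tracks-first : ∀ {occ seen} a → countL a seen ≡ 0 → Tracks occ seen → Tracks (a ∷ occ) (a ∷ seen)
Tracks-first {occ} {seen} a c≡0 tracks s = mk⇔ to from
  where
  to : s ∈ a ∷ occ → Occupied (a ∷ seen) s
  to (here refl) = Occupied-here a seen
  to (there s∈occ) = Occupied-∷⁺ a seen s (Equivalence.to (tracks s) s∈occ)
  from : Occupied (a ∷ seen) s → s ∈ a ∷ occ
  from occupied with Occupied-∷⁻ a seen s occupied
  ... | inj₁ s≡a = here s≡a
  ... | inj₂ (inj₁ (_ , c>0)) = ⊥-elim (<-irrefl (sym c≡0) c>0)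
  ... | inj₂ (inj₂ occupied′) = there (Equivalence.from (tracks s) occupied′)

Tracks-second : ∀ {occ seen} a → 0 < countL a seen → Tracks occ seen → Tracks (suc a ∷ occ) (a ∷ seen)
Tracks-second {occ} {seen} a c>0 tracks s = mk⇔ to from
  where
  to : s ∈ suc a ∷ occ → Occupied (a ∷ seen) s
  to (here refl) = Occupied-next a seen c>0
  to (there s∈occ) = Occupied-∷⁺ a seen s (Equivalence.to (tracks s) s∈occ)
  from : Occupied (a ∷ seen) s → s ∈ suc a ∷ occ
  from occupied with Occupied-∷⁻ a seen s occupied
  ... | inj₁ refl = there (Equivalence.from (tracks a) (Occupied-countL seen a c>0))
  ... | inj₂ (inj₁ (s≡1+a , _)) = here s≡1+a
  ... | inj₂ (inj₂ occupied′) = there (Equivalence.from (tracks s) occupied′)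

record Partitions (seen rest xs : List ℕ) : Set where
  constructor partitions
  field countL-+ : ∀ v → countL v seen + countL v rest ≡ countL v xs
open Partitions

Partitions-shift : ∀ {seen a rest xs} → Partitions seen (a ∷ rest) xs → Partitions (a ∷ seen) rest xs
Partitions-shift {seen} {a} {rest} {xs} part = partitions shifted
  where
  shifted : ∀ v → countL v (a ∷ seen) + countL v rest ≡ countL v xs
  shifted v with a ≟ v
  ... | yes refl = begin
    suc (countL a seen) + countL a rest ≡⟨ +-suc (countL a seen) (countL a rest) ⟨
    countL a seen + suc (countL a rest) ≡⟨ cong (countL a seen +_) (countL-∷-≡ a rest) ⟨
    countL a seen + countL a (a ∷ rest) ≡⟨ countL-+ part a ⟩
    countL a xs                         ∎
    where open ≡-Reasoning
  ... | no a≢v = trans (cong (countL v seen +_) (sym (countL-∷-≢ rest a≢v))) (countL-+ part v)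

Partitions-≤ : ∀ {seen rest xs} → Partitions seen rest xs → ∀ v → countL v seen ≤ countL v xs
Partitions-≤ {seen} {rest} part v = subst (countL v seen ≤_) (countL-+ part v) (m≤m+n _ _)

Partitions-head : ∀ {seen a rest xs} → Partitions seen (a ∷ rest) xs → countL a seen < countL a xs
Partitions-head {seen} {a} {rest} part = subst (countL a seen <_) eq (m<m+n _ z<s)
  where
  eq : countL a seen + suc (countL a rest) ≡ _
  eq = trans (cong (countL a seen +_) (sym (countL-∷-≡ a rest))) (countL-+ part a)

lookup-∀⇒∈-toList : ∀ (P : ℕ → Set) {n} (α : Vec ℕ n) → (∀ j → P (lookup α j)) → ∀ {x} → x ∈ toList α → P x
lookup-∀⇒∈-toList P α all {x} x∈α = subst P (sym (lookup-index x∈α′)) (all (VecAny.index x∈α′))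
  where
  x∈α′ : VecAny.Any (x ≡_) α
  x∈α′ = toList⁻ x∈α

InRange⇒∈-toList-≤ : ∀ {n} (α : Vec ℕ n) → InRange α → ∀ {x} → x ∈ toList α → x ≤ n
InRange⇒∈-toList-≤ {n} α range = lookup-∀⇒∈-toList (_≤ n) α (λ j → proj₂ (range j))

Fubini⇒countL>0 : ∀ {n} (α : Vec ℕ n) → IsFubiniRanking α →
                  ∀ {x} → 0 < count x α → x ≡ suc (countLessL x (toList α))
Fubini⇒countL>0 α (_ , fubini) c>0 =
  lookup-∀⇒∈-toList (λ x → x ≡ suc (countLessL x (toList α))) α
    (λ j → trans (fubini j) (cong suc (countLess≡countLessL _ α))) (countL>0⇒∈ (toList α) c>0)

≡2-squeeze : ∀ {w l c} → l ≤ w → (0 < c → w ≡ suc l) → c ≤ 2 → suc w ≤ l + c → c ≡ 2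
≡2-squeeze {c = zero} l≤w _ _ 1+w≤l+0 = ⊥-elim (<⇒≱ (subst (suc _ ≤_) (+-identityʳ _) 1+w≤l+0) l≤w)
≡2-squeeze {l = l} {c = suc k} _ fubini c≤2 1+w≤l+c with refl ← fubini z<s =
  ≤-antisym c≤2 (+-cancelˡ-≤ l 2 (suc k) (subst (_≤ l + suc k) (+-comm 2 l) 1+w≤l+c))

≤2∧≢0∧≢2⇒≡1 : ∀ {c} → c ≤ 2 → c ≢ 0 → c ≢ 2 → c ≡ 1
≤2∧≢0∧≢2⇒≡1 {0} _ c≢0 _ = ⊥-elim (c≢0 refl)
≤2∧≢0∧≢2⇒≡1 {1} _ _ _ = refl
≤2∧≢0∧≢2⇒≡1 {2} _ _ c≢2 = ⊥-elim (c≢2 refl)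
≤2∧≢0∧≢2⇒≡1 {suc (suc (suc _))} (s≤s (s≤s ())) _ _

module FubiniAtMostTwice {n} (α : Vec ℕ n) (fubini : IsFubiniRanking α) (≤2 : ∀ v → count v α ≤ 2) where

  private
    B : List ℕ
    B = toList α

  fubini-countL : ∀ {x} → 0 < countL x B → x ≡ suc (countLessL x B)
  fubini-countL = Fubini⇒countL>0 α fubini

  countLessL-total : countLessL (suc n) B ≡ n
  countLessL-total = trans (countLessL-above n B (InRange⇒∈-toList-≤ α (proj₁ fubini))) (length-toList α)

  countLessL≤ : ∀ x → countLessL x B ≤ x
  countLessL≤ zero = ≤-reflexive (countLessL-zero B)
  countLessL≤ (suc x) with countL x B in c≡
  ... | zero = m≤n⇒m≤1+n (≤-trans (≤-reflexive (countLessL-suc-absent x B c≡)) (countLessL≤ x))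
  ... | suc _ = begin
    countLessL (suc x) B        ≡⟨ countLessL-suc x B ⟩
    countLessL x B + countL x B ≤⟨ +-monoʳ-≤ (countLessL x B) (≤2 x) ⟩
    countLessL x B + 2          ≡⟨ +-comm (countLessL x B) 2 ⟩
    suc (suc (countLessL x B))  ≡⟨ cong suc (fubini-countL (subst (0 <_) (sym c≡) z<s)) ⟨
    suc x                       ∎
    where open ≤-Reasoning

  -- Downward induction from countLessL (suc n) B ≡ n: a value z that occurs satisfies
  -- z ≡ suc (countLessL z B), and one that does not has countLessL z B ≡ countLessL (suc z) B.
  countLessL-lower : ∀ z → z ≤ suc n → z ≤ suc (countLessL z B)
  countLessL-lower z z≤1+n = descend (suc n ∸ z) z (m∸n+n≡m z≤1+n)
    where
    descend : ∀ k z → k + z ≡ suc n → z ≤ suc (countLessL z B)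
    descend zero z refl = ≤-reflexive (cong suc (sym countLessL-total))
    descend (suc k) z k+z≡ with countL z B in c≡
    ... | zero = begin
      z                        ≤⟨ s≤s⁻¹ (descend k (suc z) (trans (+-suc k z) k+z≡)) ⟩
      countLessL (suc z) B     ≡⟨ countLessL-suc-absent z B c≡ ⟩
      countLessL z B           ≤⟨ n≤1+n _ ⟩
      suc (countLessL z B)     ∎
      where open ≤-Reasoning
    ... | suc _ = ≤-reflexive (fubini-countL (subst (0 <_) (sym c≡) z<s))

  absent⇒predecessor-twice : ∀ w → suc w ≤ n → countL (suc w) B ≡ 0 → countL w B ≡ 2
  absent⇒predecessor-twice w 1+w≤n c≡0 = ≡2-squeeze (countLessL≤ w) fubini-countL (≤2 w) lower
    where
    open ≤-Reasoning
    lower : suc w ≤ countLessL w B + countL w B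
    lower = begin
      suc w                       ≤⟨ s≤s⁻¹ (countLessL-lower (suc (suc w)) (s≤s 1+w≤n)) ⟩
      countLessL (suc (suc w)) B  ≡⟨ countLessL-suc-absent (suc w) B c≡0 ⟩
      countLessL (suc w) B        ≡⟨ countLessL-suc w B ⟩
      countLessL w B + countL w B ∎

  neither-twice⇒successor-once : ∀ v → suc v ≤ n → count v α ≢ 2 → count (suc v) α ≢ 2 → count (suc v) α ≡ 1
  neither-twice⇒successor-once v 1+v≤n ≢2[v] ≢2[1+v] =
    ≤2∧≢0∧≢2⇒≡1 (≤2 (suc v)) (≢2[v] ∘ absent⇒predecessor-twice v 1+v≤n) ≢2[1+v]

  twice⇒successor-absent : ∀ v → 2 ≤ countL v B → ¬ (0 < countL (suc v) B)
  twice⇒successor-absent v c≥2 c′>0 = <-irrefl (sym c≡1) c≥2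
    where
    open ≡-Reasoning
    c≡1 : countL v B ≡ 1
    c≡1 = +-cancelˡ-≡ (countLessL v B) _ _ (begin
      countLessL v B + countL v B ≡⟨ countLessL-suc v B ⟨
      countLessL (suc v) B        ≡⟨ suc-injective (fubini-countL c′>0) ⟨
      v                           ≡⟨ fubini-countL (<-≤-trans z<s c≥2) ⟩
      suc (countLessL v B)        ≡⟨ +-comm 1 (countLessL v B) ⟩
      countLessL v B + 1          ∎)

  twice⇒successor≤n : ∀ v → 2 ≤ countL v B → suc v ≤ n
  twice⇒successor≤n v c≥2 = begin
    suc v                       ≡⟨ cong suc (fubini-countL (<-≤-trans z<s c≥2)) ⟩
    suc (suc (countLessL v B))  ≡⟨ +-comm 2 (countLessL v B) ⟩
    countLessL v B + 2          ≤⟨ +-monoʳ-≤ (countLessL v B) c≥2 ⟩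
    countLessL v B + countL v B ≡⟨ countLessL-suc v B ⟨
    countLessL (suc v) B        ≤⟨ countLessL≤length (suc v) B ⟩
    length B                    ≡⟨ length-toList α ⟩
    n                           ∎
    where open ≤-Reasoning

  first-spot-free : ∀ {seen a rest} → Partitions seen (a ∷ rest) B → countL a seen ≡ 0 → ¬ Occupied seen a
  first-spot-free {a = zero} _ c≡0 c>0 = <-irrefl (sym c≡0) c>0
  first-spot-free {a = suc v} _ c≡0 (inj₁ c>0) = <-irrefl (sym c≡0) c>0
  first-spot-free {a = suc v} part _ (inj₂ c≥2) =
    twice⇒successor-absent v (≤-trans c≥2 (Partitions-≤ part v)) (<-≤-trans z<s (Partitions-head part))

  next-spot-free : ∀ {seen a rest} → Partitions seen (a ∷ rest) B → 0 < countL a seen → ¬ Occupied seen (suc a)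
  next-spot-free {a = a} part c>0 (inj₁ c′>0) =
    twice⇒successor-absent a (<-≤-trans (s≤s c>0) (Partitions-head part)) (≤-trans c′>0 (Partitions-≤ part (suc a)))
  next-spot-free {a = a} part _ (inj₂ c≥2) = <⇒≱ (<-≤-trans (s≤s c≥2) (Partitions-head part)) (≤2 a)

  park : ∀ seen rest occ → Partitions seen rest B → Tracks occ seen →
         ∃[ ps ] parkFrom n occ rest ≡ just ps × UnitCond rest ps
  park seen [] occ _ _ = [] , refl , tt
  park seen (a ∷ rest) occ part tracks with countL a seen in c≡
  ... | zero =
    let ps , parks , unit = park (a ∷ seen) rest (a ∷ occ) (Partitions-shift part) (Tracks-first a c≡ tracks)
    in a ∷ ps , parkFrom-∷ n occ a rest (firstFree-here n occ a n a≤n a∉occ) parks , inj₁ refl , unit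
    where
    a≤n : a ≤ n
    a≤n = InRange⇒∈-toList-≤ α (proj₁ fubini) (countL>0⇒∈ B (<-≤-trans z<s (Partitions-head part)))
    a∉occ : a ∉ occ
    a∉occ a∈occ = first-spot-free part c≡ (Equivalence.to (tracks a) a∈occ)
  ... | suc _ =
    let ps , parks , unit = park (a ∷ seen) rest (suc a ∷ occ) (Partitions-shift part) (Tracks-second a c>0 tracks)
    in suc a ∷ ps , parkFrom-∷ n occ a rest (firstFree-next n occ a 1+a≤n a∈occ 1+a∉occ) parks , inj₂ refl , unit
    where
    c>0 : 0 < countL a seen
    c>0 = subst (0 <_) (sym c≡) z<s
    1+a≤n : suc a ≤ n
    1+a≤n = twice⇒successor≤n a (<-≤-trans (s≤s c>0) (Partitions-head part))
    a∈occ : a ∈ occ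
    a∈occ = Equivalence.from (tracks a) (Occupied-countL seen a c>0)
    1+a∉occ : suc a ∉ occ
    1+a∉occ 1+a∈occ = next-spot-free part c>0 (Equivalence.to (tracks (suc a)) 1+a∈occ)

  unitIntervalPF : IsUnitIntervalPF α
  unitIntervalPF = proj₁ fubini , park [] B [] (partitions (λ _ → refl)) Tracks-[]

lower : ℕ → ℕ → ℕ
lower i a = if ⌊ a ≟ suc i ⌋ then i else a

countL-map-lower-i : ∀ i xs → countL i (List.map (lower i) xs) ≡ countL i xs + countL (suc i) xs
countL-map-lower-i i [] = refl
countL-map-lower-i i (x ∷ xs) with x ≟ suc i
... | yes refl = begin
  countL i (i ∷ List.map (lower i) xs)       ≡⟨ countL-∷-≡ i (List.map (lower i) xs) ⟩
  suc (countL i (List.map (lower i) xs))     ≡⟨ cong suc (countL-map-lower-i i xs) ⟩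
  suc (countL i xs + countL (suc i) xs)      ≡⟨ +-suc (countL i xs) _ ⟨
  countL i xs + suc (countL (suc i) xs)      ≡⟨ cong (_+ suc (countL (suc i) xs)) (countL-∷-≢ xs 1+n≢n) ⟨
  countL i (suc i ∷ xs) + suc (countL (suc i) xs) ∎
  where open ≡-Reasoning
... | no _ with x ≟ i
...   | yes _ = cong suc (countL-map-lower-i i xs)
...   | no _ = countL-map-lower-i i xs

countL-map-lower-suc : ∀ i xs → countL (suc i) (List.map (lower i) xs) ≡ 0
countL-map-lower-suc i [] = refl
countL-map-lower-suc i (x ∷ xs) with x ≟ suc i
... | yes _ = trans (countL-∷-≢ (List.map (lower i) xs) (1+n≢n ∘ sym)) (countL-map-lower-suc i xs)
... | no x≢1+i = trans (countL-∷-≢ (List.map (lower i) xs) x≢1+i) (countL-map-lower-suc i xs)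

countL-map-lower-other : ∀ i v xs → v ≢ i → v ≢ suc i → countL v (List.map (lower i) xs) ≡ countL v xs
countL-map-lower-other i v [] _ _ = refl
countL-map-lower-other i v (x ∷ xs) v≢i v≢1+i with x ≟ suc i
... | yes refl = trans (countL-∷-≢ (List.map (lower i) xs) (v≢i ∘ sym))
                   (trans (countL-map-lower-other i v xs v≢i v≢1+i) (sym (countL-∷-≢ xs (v≢1+i ∘ sym))))
... | no _ with x ≟ v
...   | yes _ = cong suc (countL-map-lower-other i v xs v≢i v≢1+i)
...   | no _ = countL-map-lower-other i v xs v≢i v≢1+i

countLessL-map-lower : ∀ i x xs → x ≢ suc i → countLessL x (List.map (lower i) xs) ≡ countLessL x xs
countLessL-map-lower i x [] _ = refl
countLessL-map-lower i x (r ∷ rs) x≢1+i with r ≟ suc i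
... | yes refl with i <? x | suc i <? x
...   | yes _   | yes _ = cong suc (countLessL-map-lower i x rs x≢1+i)
...   | no _    | no _  = countLessL-map-lower i x rs x≢1+i
...   | yes i<x | no 1+i≮x = ⊥-elim (1+i≮x (≤∧≢⇒< i<x (x≢1+i ∘ sym)))
...   | no i≮x  | yes 1+i<x = ⊥-elim (i≮x (<-trans (n<1+n i) 1+i<x))
countLessL-map-lower i x (r ∷ rs) x≢1+i | no _ with r <? x
...   | yes _ = cong suc (countLessL-map-lower i x rs x≢1+i)
...   | no _ = countLessL-map-lower i x rs x≢1+i

hat-InRange : ∀ {n} i (α : Vec ℕ n) → 1 ≤ i → i < n → InRange α → InRange (hat i α)
hat-InRange {n} i α 1≤i i<n range j =
  subst (λ a → 1 ≤ a × a ≤ n) (sym (lookup-map j (lower i) α)) (bounds (lookup α j) (range j))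
  where
  bounds : ∀ a → 1 ≤ a × a ≤ n → 1 ≤ lower i a × lower i a ≤ n
  bounds a a∈[n] with a ≟ suc i
  ... | yes _ = 1≤i , <⇒≤ i<n
  ... | no _ = a∈[n]

-- Only the entry i + 1 changes, to i, which satisfies the Fubini equation because it occurs in α.
hat-Fubini : ∀ {n} i (α : Vec ℕ n) → 1 ≤ i → i < n → IsFubiniRanking α → 0 < count i α →
             IsFubiniRanking (hat i α)
hat-Fubini i α 1≤i i<n fubini c>0 = hat-InRange i α 1≤i i<n (proj₁ fubini) , fubini′
  where
  xs : List ℕ
  xs = toList α
  lower-fubini : ∀ y → y ≡ suc (countLessL y xs) → lower i y ≡ suc (countLessL (lower i y) (List.map (lower i) xs))
  lower-fubini y fy with y ≟ suc i
  ... | yes _ = trans (Fubini⇒countL>0 α fubini c>0) (cong suc (sym (countLessL-map-lower i i xs (1+n≢n ∘ sym))))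
  ... | no y≢1+i = trans fy (cong suc (sym (countLessL-map-lower i y xs y≢1+i)))
  fubini′ : ∀ j → lookup (hat i α) j ≡ suc (countLess (lookup (hat i α) j) (hat i α))
  fubini′ j = begin
    lookup (hat i α) j                                  ≡⟨ lookup-map j (lower i) α ⟩
    lower i y                                           ≡⟨ lower-fubini y (trans (proj₂ fubini j) (cong suc (countLess≡countLessL y α))) ⟩
    suc (countLessL (lower i y) (List.map (lower i) xs)) ≡⟨ cong (λ ys → suc (countLessL (lower i y) ys)) (toList-map (lower i) α) ⟨
    suc (countLessL (lower i y) (toList (hat i α)))     ≡⟨ cong suc (countLess≡countLessL (lower i y) (hat i α)) ⟨
    suc (countLess (lower i y) (hat i α))               ≡⟨ cong (λ a → suc (countLess a (hat i α))) (lookup-map j (lower i) α) ⟨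
    suc (countLess (lookup (hat i α) j) (hat i α))      ∎
    where
    open ≡-Reasoning
    y : ℕ
    y = lookup α j

hat-count≤2 : ∀ {n} i (α : Vec ℕ n) → (∀ v → count v α ≤ 2) → count i α + count (suc i) α ≤ 2 →
              ∀ v → count v (hat i α) ≤ 2
hat-count≤2 i α ≤2 merged≤2 v = subst (_≤ 2) (cong (countL v) (sym (toList-map (lower i) α))) (bound v)
  where
  xs : List ℕ
  xs = toList α
  bound : ∀ v → countL v (List.map (lower i) xs) ≤ 2
  bound v with v ≟ i | v ≟ suc i
  ... | yes refl | _ = subst (_≤ 2) (sym (countL-map-lower-i v xs)) merged≤2
  ... | no _ | yes refl = subst (_≤ 2) (sym (countL-map-lower-suc i xs)) z≤n
  ... | no v≢i | no v≢1+i = subst (_≤ 2) (sym (countL-map-lower-other i v xs v≢i v≢1+i)) (≤2 v)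

lemma3p10 : (n i : ℕ) → 1 ≤ i → i < n → (α : Vec ℕ n) → IsUFR α →
    ¬ (count (i ∸ 1) α ≡ 2) → ¬ (count i α ≡ 2) → ¬ (count (suc i) α ≡ 2) →
    count (suc i) α ≡ 1 × IsUFR (hat i α)
lemma3p10 n i@(suc w) 1≤i i<n α (fubini , unitPF) ≢2[i∸1] ≢2[i] ≢2[1+i] = once[1+i] , fubini′ , Hat.unitIntervalPF
  where
  ≤2 : ∀ v → count v α ≤ 2
  ≤2 = UnitIntervalPF⇒count≤2 unitPF
  open FubiniAtMostTwice α fubini ≤2
  once[i] : count i α ≡ 1
  once[i] = neither-twice⇒successor-once w (<⇒≤ i<n) ≢2[i∸1] ≢2[i]
  once[1+i] : count (suc i) α ≡ 1
  once[1+i] = neither-twice⇒successor-once i i<n ≢2[i] ≢2[1+i]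
  fubini′ : IsFubiniRanking (hat i α)
  fubini′ = hat-Fubini i α 1≤i i<n fubini (subst (0 <_) (sym once[i]) z<s)
  module Hat = FubiniAtMostTwice (hat i α) fubini′ (hat-count≤2 i α ≤2 (≤-reflexive (cong₂ _+_ once[i] once[1+i])))
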